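{- Let $A$ be a finite set and $(X_a)_{a\in A}$ an indexed family of non-empty finite subsets of $\mathbb{Z}$. For every $(t_a)_{a\in A}\in\mathbb{Z}^A$ that minimizes $\left|\bigcup_{a\in A}(X_a+t_a)\right|$ over $\mathbb{Z}^A$, the intersection graph of $(X_a+t_a)_{a\in A}$ is connected.
   Context: The intersection graph of a family $(Y_a)_{a\in A}$ of sets is the graph with vertex set $A$ in which, for distinct $b,c\in A$, $\{b,c\}$ is an edge if and only if $Y_b\cap Y_c\neq\emptyset$. Here $X+t=\{x+t: x\in X\}$. -}

module Defs where

open import Data.Nat using (ℕ)
open import Data.Integer using (ℤ; _+_; _≟_)
open import Data.Fin using (Fin)
open import Data.List using (List; []; map; concatMap; length; deduplicate; allFin)
open import Data.List.Membership.Propositional using (_∈_)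
open import Data.Product using (∃; _×_)
open import Relation.Binary.PropositionalEquality using (_≡_; _≢_)

-- A finite subset of ℤ is represented by a list of its elements
-- (duplicates are harmless: membership and cardinality are computed up to them).

shift : List ℤ → ℤ → List ℤ
shift X t = map (_+ t) X

shifted : ∀ {n} → (Fin n → List ℤ) → (Fin n → ℤ) → Fin n → List ℤ
shifted X t a = shift (X a) (t a)

card : List ℤ → ℕ
card xs = length (deduplicate _≟_ xs)

⋃ : ∀ {n} → (Fin n → List ℤ) → List ℤ
⋃ {n} Y = concatMap Y (allFin n)

Edge : ∀ {n} → (Fin n → List ℤ) → Fin n → Fin n → Set
Edge Y b c = b ≢ c × ∃ λ x → x ∈ Y b × x ∈ Y c

data Reach {n} (Y : Fin n → List ℤ) : Fin n → Fin n → Set where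
  here : ∀ {a} → Reach Y a a
  step : ∀ {a b c} → Edge Y a b → Reach Y b c → Reach Y a c

IntersectionGraphConnected : ∀ {n} → (Fin n → List ℤ) → Set
IntersectionGraphConnected {n} Y = (a b : Fin n) → Reach Y a b

module Submission where

-- Fix a minimiser t and write Y_a = X_a + t_a.  Suppose the
-- intersection graph of (Y_a) is not connected: some vertex b is not reachable
-- from a.  The set P of vertices reachable from a is then closed under edges,
-- contains a and misses b.  Pick x ∈ Y_a and y ∈ Y_b and translate every Y_c
-- with c ∈ P by T = y - x.  Because P is a union of components, the points
-- covered by P-sets are covered by no other set, so the new union is the image
-- of the old one under the map `move T` adding T exactly on P-covered points.
-- But move T x = y = move T y with x ≠ y, so the union loses a point, contradicting
-- minimality.

open import Defs
open import Data.Nat using (ℕ; _≤_)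
open import Data.Integer using (ℤ)
open import Data.Fin using (Fin)
open import Data.List using (List; [])
open import Relation.Binary.PropositionalEquality using (_≢_)

open import Data.Nat as ℕ using (zero; suc; _<_; s≤s)
import Data.Nat.Properties as ℕP
open import Data.Integer using (0ℤ; _+_; _-_; -_; _≟_)
import Data.Integer.Properties as ℤP
import Data.Fin as Fin
import Data.Fin.Properties as FinP
open import Data.List using (_∷_; _++_; length; map; filter; allFin; deduplicate)
open import Data.List.Properties using (length-++; length-map; length-filter; length-tabulate)
open import Data.List.Membership.Propositional using (_∈_; find; lose)
open import Data.List.Membership.Propositional.Properties
  using (∈-∃++; ∈-length; ∈-map⁺; ∈-map⁻; ∈-concatMap⁺; ∈-concatMap⁻; ∈-filter⁺; ∈-filter⁻; ∈-deduplicate⁺; ∈-deduplicate⁻; ∈-allFin)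
open import Data.List.Membership.DecPropositional _≟_ using (_∈?_)
open import Data.List.Relation.Unary.Any using (Any; here; there; any?)
open import Data.List.Relation.Unary.All as All using ()
open import Data.List.Relation.Unary.AllPairs using (_∷_)
open import Data.List.Relation.Unary.Unique.Propositional using (Unique)
open import Data.List.Relation.Unary.Unique.Propositional.Properties using (filter⁺; allFin⁺)
open import Data.List.Relation.Unary.Unique.DecPropositional.Properties using (deduplicate-!)
open import Data.List.Relation.Binary.Subset.Propositional using (_⊆_)
open import Data.Product using (∃; ∃₂; _×_; _,_; proj₂)
open import Data.Sum using (_⊎_; inj₁; inj₂)
open import Data.Empty using (⊥-elim)
open import Relation.Nullary using (¬_; Dec; yes; no)
open import Relation.Nullary.Decidable using (_×-dec_; _⊎-dec_; ¬?; map′; decidable-stable)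
open import Relation.Unary using (Decidable)
open import Relation.Binary.Definitions using (DecidableEquality)
open import Relation.Binary.PropositionalEquality using (_≡_; refl; sym; trans; cong; subst; module ≡-Reasoning)

private variable A B : Set

∈-skip : ∀ (Pl : List A) {x v Ql} → v ∈ Pl ++ x ∷ Ql → v ≢ x → v ∈ Pl ++ Ql
∈-skip []       (here v≡x) v≢x = ⊥-elim (v≢x v≡x)
∈-skip []       (there v∈) _   = v∈
∈-skip (_ ∷ Pl) (here v≡p) _   = here v≡p
∈-skip (_ ∷ Pl) (there v∈) v≢x = there (∈-skip Pl v∈ v≢x)

length-skip : ∀ (Pl : List A) {x} Ql → length (Pl ++ x ∷ Ql) ≡ suc (length (Pl ++ Ql))
length-skip Pl {x} Ql = begin
  length (Pl ++ x ∷ Ql)            ≡⟨ length-++ Pl ⟩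
  length Pl ℕ.+ suc (length Ql)    ≡⟨ ℕP.+-suc (length Pl) (length Ql) ⟩
  suc (length Pl ℕ.+ length Ql)    ≡⟨ cong suc (sym (length-++ Pl)) ⟩
  suc (length (Pl ++ Ql))          ∎
  where open ≡-Reasoning

unique-length-≤ : ∀ {l m : List A} → Unique l → l ⊆ m → length l ≤ length m
unique-length-≤ {l = []}    _ _ = ℕ.z≤n
unique-length-≤ {l = x ∷ l} (x∉l ∷ ul) l⊆m with ∈-∃++ (l⊆m (here refl))
... | Pl , Ql , refl = subst (suc (length l) ≤_) (sym (length-skip Pl Ql))
    (s≤s (unique-length-≤ ul λ z∈l → ∈-skip Pl (l⊆m (there z∈l)) (λ z≡x → All.lookup x∉l z∈l (sym z≡x))))

-- If g identifies two distinct elements x, y of m, a duplicate-free list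
-- inside the image of m under g is strictly shorter than m: the image is
-- already covered by m with x removed.
collapse-length-< : (_≟_ : DecidableEquality A) (g : A → B) {l : List B} {m : List A} {x y : A} →
  Unique l → (∀ {z} → z ∈ l → ∃ λ u → u ∈ m × z ≡ g u) →
  x ∈ m → y ∈ m → x ≢ y → g x ≡ g y → length l < length m
collapse-length-< _≟_ g {l} ul l⊆gm x∈m y∈m x≢y gx≡gy with ∈-∃++ x∈m
... | Pl , Ql , refl = subst (length l <_) (sym (length-skip Pl Ql))
    (s≤s (subst (length l ≤_) (length-map g (Pl ++ Ql)) (unique-length-≤ ul l⊆g[m-x])))
  where
  l⊆g[m-x] : l ⊆ map g (Pl ++ Ql)
  l⊆g[m-x] z∈l with l⊆gm z∈l
  ... | u , u∈m , refl with u ≟ _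
  ... | no u≢x     = ∈-map⁺ g (∈-skip Pl u∈m u≢x)
  ... | yes refl   = subst (_∈ map g (Pl ++ Ql)) (sym gx≡gy)
                       (∈-map⁺ g (∈-skip Pl y∈m (λ y≡x → x≢y (sym y≡x))))

module BoundedReachability {n : ℕ} (E : Fin n → Fin n → Set) (E? : ∀ c d → Dec (E c d)) where

  Within : ℕ → Fin n → Fin n → Set
  Within zero    a c = a ≡ c
  Within (suc k) a c = a ≡ c ⊎ ∃ λ b → E a b × Within k b c

  within? : ∀ k a c → Dec (Within k a c)
  within? zero    a c = a Fin.≟ c
  within? (suc k) a c = (a Fin.≟ c) ⊎-dec FinP.any? (λ b → E? a b ×-dec within? k b c)

  within-refl : ∀ k {a} → Within k a a
  within-refl zero    = refl
  within-refl (suc k) = inj₁ refl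

  within-suc : ∀ k {a c} → Within k a c → Within (suc k) a c
  within-suc zero    refl                = inj₁ refl
  within-suc (suc k) (inj₁ a≡c)          = inj₁ a≡c
  within-suc (suc k) (inj₂ (b , e , w))  = inj₂ (b , e , within-suc k w)

  within-snoc : ∀ k {a c d} → Within k a c → E c d → Within (suc k) a d
  within-snoc zero    refl                e = inj₂ (_ , e , refl)
  within-snoc (suc k) (inj₁ refl)         e = inj₂ (_ , e , within-refl (suc k))
  within-snoc (suc k) (inj₂ (b , e′ , w)) e = inj₂ (b , e′ , within-snoc k w e)

  module _ (a : Fin n) where

    ball : ℕ → List (Fin n)
    ball k = filter (within? k a) (allFin n)

    ∈-ball⁺ : ∀ {k v} → Within k a v → v ∈ ball k
    ∈-ball⁺ {k} {v} w = ∈-filter⁺ (within? k a) (∈-allFin v) w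

    ∈-ball⁻ : ∀ {k v} → v ∈ ball k → Within k a v
    ∈-ball⁻ {k} v∈ = proj₂ (∈-filter⁻ (within? k a) {xs = allFin n} v∈)

    ball-length-≤ : ∀ k → length (ball k) ≤ n
    ball-length-≤ k = subst (length (ball k) ≤_) (length-tabulate (λ i → i)) (length-filter (within? k a) (allFin n))

    Closed : ℕ → Set
    Closed k = ∀ {c d} → Within k a c → E c d → Within k a d

    closed-or-exit : ∀ k → Closed k ⊎ ∃₂ λ c d → Within k a c × E c d × ¬ Within k a d
    closed-or-exit k with FinP.any? (λ c → FinP.any? (λ d → within? k a c ×-dec (E? c d ×-dec ¬? (within? k a d))))
    ... | yes (c , d , w , e , ¬w) = inj₂ (c , d , w , e , ¬w)
    ... | no ¬exit = inj₁ λ {c} {d} w e → decidable-stable (within? k a d) (λ ¬w → ¬exit (c , d , w , e , ¬w))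

    exit⇒growth : ∀ k {c d} → Within k a c → E c d → ¬ Within k a d →
                  length (ball k) < length (ball (suc k))
    exit⇒growth k {d = d} w e ¬w = unique-length-≤ (d∉ ∷ filter⁺ (within? k a) (allFin⁺ n)) d∷ball⊆next
      where
      d∉ : All.All (d ≢_) (ball k)
      d∉ = All.tabulate λ v∈ d≡v → ¬w (subst (Within k a) (sym d≡v) (∈-ball⁻ v∈))
      d∷ball⊆next : (d ∷ ball k) ⊆ ball (suc k)
      d∷ball⊆next (here refl) = ∈-ball⁺ (within-snoc k w e)
      d∷ball⊆next (there v∈)  = ∈-ball⁺ (within-suc k (∈-ball⁻ v∈))

    -- Balls keep growing until closed; since they have at most n elements,
    -- this happens within n rounds.  `fuel` counts the remaining rounds.
    closed-eventually : ∀ fuel k → fuel ℕ.+ k ≡ n → k < length (ball k) → ∃ Closed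
    closed-eventually zero k refl k<ball = ⊥-elim (ℕP.<⇒≱ k<ball (ball-length-≤ k))
    closed-eventually (suc fuel) k fuel+k≡n k<ball with closed-or-exit k
    ... | inj₁ closed = k , closed
    ... | inj₂ (c , d , w , e , ¬w) =
      closed-eventually fuel (suc k) (trans (ℕP.+-suc fuel k) fuel+k≡n)
        (ℕP.<-≤-trans (s≤s k<ball) (exit⇒growth k w e ¬w))

    closure : ∃ Closed
    closure = closed-eventually n 0 (ℕP.+-identityʳ n)
      (∈-length (∈-ball⁺ {0} refl))

module _ {n : ℕ} (Y : Fin n → List ℤ) where

  ∈-⋃⁺ : ∀ {z} c → z ∈ Y c → z ∈ ⋃ Y
  ∈-⋃⁺ c z∈ = ∈-concatMap⁺ Y {xs = allFin n} (lose (∈-allFin c) z∈)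

  ∈-⋃⁻ : ∀ {z} → z ∈ ⋃ Y → ∃ λ c → z ∈ Y c
  ∈-⋃⁻ z∈ with find (∈-concatMap⁻ Y {xs = allFin n} z∈)
  ... | c , _ , z∈c = c , z∈c

  edge? : ∀ b c → Dec (Edge Y b c)
  edge? b c = ¬? (b Fin.≟ c) ×-dec map′ common⁺ common⁻ (any? (_∈? Y c) (Y b))
    where
    common⁺ : Any (_∈ Y c) (Y b) → ∃ λ x → x ∈ Y b × x ∈ Y c
    common⁺ p with find p
    ... | x , x∈b , x∈c = x , x∈b , x∈c
    common⁻ : (∃ λ x → x ∈ Y b × x ∈ Y c) → Any (_∈ Y c) (Y b)
    common⁻ (_ , x∈b , x∈c) = lose x∈b x∈c

  open BoundedReachability (Edge Y) edge? public

  within⇒reach : ∀ k {a c} → Within k a c → Reach Y a c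
  within⇒reach zero    refl               = here
  within⇒reach (suc k) (inj₁ refl)        = here
  within⇒reach (suc k) (inj₂ (b , e , w)) = step e (within⇒reach k w)

shiftIf : {Q : Set} → Dec Q → ℤ → ℤ
shiftIf (yes _) T = T
shiftIf (no _)  _ = 0ℤ

shiftIf-yes : ∀ {Q : Set} (q? : Dec Q) T → Q → shiftIf q? T ≡ T
shiftIf-yes (yes _) T _ = refl
shiftIf-yes (no ¬q) T q = ⊥-elim (¬q q)

shiftIf-no : ∀ {Q : Set} (q? : Dec Q) T → ¬ Q → shiftIf q? T ≡ 0ℤ
shiftIf-no (yes q) T ¬q = ⊥-elim (¬q q)
shiftIf-no (no _)  T _  = refl

shiftIf-⇔ : ∀ {Q R : Set} (q? : Dec Q) (r? : Dec R) T → (Q → R) → (R → Q) → shiftIf q? T ≡ shiftIf r? T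
shiftIf-⇔ (yes q) r? T q⇒r _ = sym (shiftIf-yes r? T (q⇒r q))
shiftIf-⇔ (no ¬q) r? T _ r⇒q = sym (shiftIf-no r? T (λ r → ¬q (r⇒q r)))

x+[y-x]≡y : ∀ x y → x + (y - x) ≡ y
x+[y-x]≡y x y = begin
  x + (y - x)     ≡⟨ cong (x +_) (ℤP.+-comm y (- x)) ⟩
  x + (- x + y)   ≡⟨ sym (ℤP.+-assoc x (- x) y) ⟩
  (x - x) + y     ≡⟨ cong (_+ y) (ℤP.+-inverseʳ x) ⟩
  0ℤ + y          ≡⟨ ℤP.+-identityˡ y ⟩
  y               ∎
  where open ≡-Reasoning

module ComponentTranslation {n : ℕ} (X : Fin n → List ℤ) (t : Fin n → ℤ)
  {P : Fin n → Set} (P? : Decidable P)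
  (closed : ∀ {c d} → P c → Edge (shifted X t) c d → P d) where

  private
    Y : Fin n → List ℤ
    Y = shifted X t

  shares-P : ∀ {c d z} → P c → z ∈ Y c → z ∈ Y d → P d
  shares-P {c} {d} pc z∈c z∈d with c Fin.≟ d
  ... | yes refl = pc
  ... | no c≢d   = closed pc (c≢d , _ , z∈c , z∈d)

  CoveredByP : ℤ → Set
  CoveredByP z = ∃ λ c → P c × z ∈ Y c

  coveredByP? : Decidable CoveredByP
  coveredByP? z = FinP.any? (λ c → P? c ×-dec (z ∈? Y c))

  translate : ℤ → Fin n → ℤ
  translate T c = t c + shiftIf (P? c) T

  move : ℤ → ℤ → ℤ
  move T z = z + shiftIf (coveredByP? z) T

  ⋃-translate⊆image : ∀ T {z} → z ∈ ⋃ (shifted X (translate T)) → ∃ λ u → u ∈ ⋃ Y × z ≡ move T u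
  ⋃-translate⊆image T z∈ with ∈-⋃⁻ (shifted X (translate T)) z∈
  ... | c , z∈c with ∈-map⁻ (_+ translate T c) z∈c
  ... | w , w∈ , refl = w + t c , ∈-⋃⁺ Y c u∈ , moved
    where
    u∈ : w + t c ∈ Y c
    u∈ = ∈-map⁺ (_+ t c) w∈
    moved : w + translate T c ≡ move T (w + t c)
    moved = begin
      w + (t c + shiftIf (P? c) T)                   ≡⟨ sym (ℤP.+-assoc w (t c) _) ⟩
      w + t c + shiftIf (P? c) T                     ≡⟨ cong (w + t c +_) (shiftIf-⇔ (P? c) (coveredByP? (w + t c)) T
                                                          (λ pc → c , pc , u∈) (λ (d , pd , u∈d) → shares-P pd u∈d u∈)) ⟩
      w + t c + shiftIf (coveredByP? (w + t c)) T    ∎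
      where open ≡-Reasoning

  translation-shrinks : ∀ {a b x y} → P a → ¬ P b → x ∈ Y a → y ∈ Y b →
    card (⋃ (shifted X (translate (y - x)))) < card (⋃ Y)
  translation-shrinks {a} {b} {x} {y} pa ¬pb x∈ y∈ =
    collapse-length-< _≟_ (move T) (deduplicate-! _≟_ (⋃ (shifted X (translate T))))
      image (∈-deduplicate⁺ _≟_ (∈-⋃⁺ Y a x∈)) (∈-deduplicate⁺ _≟_ (∈-⋃⁺ Y b y∈))
      x≢y (trans move-x move-y)
    where
    T : ℤ
    T = y - x
    y-uncovered : ¬ CoveredByP y
    y-uncovered (c , pc , y∈c) = ¬pb (shares-P pc y∈c y∈)
    x≢y : x ≢ y
    x≢y refl = y-uncovered (a , pa , x∈)
    move-x : move T x ≡ y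
    move-x = trans (cong (x +_) (shiftIf-yes (coveredByP? x) T (a , pa , x∈))) (x+[y-x]≡y x y)
    move-y : y ≡ move T y
    move-y = sym (trans (cong (y +_) (shiftIf-no (coveredByP? y) T y-uncovered)) (ℤP.+-identityʳ y))
    image : ∀ {z} → z ∈ deduplicate _≟_ (⋃ (shifted X (translate T))) →
            ∃ λ u → u ∈ deduplicate _≟_ (⋃ Y) × z ≡ move T u
    image z∈ with ⋃-translate⊆image T (∈-deduplicate⁻ _≟_ _ z∈)
    ... | u , u∈ , z≡ = u , ∈-deduplicate⁺ _≟_ u∈ , z≡

shift-inhabited : ∀ (X : List ℤ) t → X ≢ [] → ∃ λ x → x ∈ shift X t
shift-inhabited []      t X≢[] = ⊥-elim (X≢[] refl)
shift-inhabited (w ∷ _) t _    = w + t , here refl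

lemma2 : (n : ℕ) (X : Fin n → List ℤ) → (∀ a → X a ≢ []) →
    (t : Fin n → ℤ) →
    (∀ (s : Fin n → ℤ) → card (⋃ (shifted X t)) ≤ card (⋃ (shifted X s))) →
    IntersectionGraphConnected (shifted X t)
lemma2 n X nonempty t minimal a b with closure (shifted X t) a
... | k , closed with within? (shifted X t) k a b
... | yes a⇝b = within⇒reach (shifted X t) k a⇝b
... | no  a⇝̸b with shift-inhabited (X a) (t a) (nonempty a) | shift-inhabited (X b) (t b) (nonempty b)
... | x , x∈ | y , y∈ = ⊥-elim (ℕP.<⇒≱ (translation-shrinks (within-refl (shifted X t) k) a⇝̸b x∈ y∈) (minimal _))
  where open ComponentTranslation X t (within? (shifted X t) k a) closed
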